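{- Let $k,d,n$ be positive integers with $n \ge d = 2k$. Then for every $T \subset [n]$ with $1 \le |T| \le d$, the function $\mathbbm{1}_{V(T)}: [n]^d \to \mathbb{F}_2$ lies in the $\mathbb{F}_2$-linear span of the functions $\mathbbm{1}_{S^d}$ with $S \in \mathcal{I}_k$.
   Context: $[n]=\{1,\dots,n\}$; for integers $a \le b$, $[a,b]=\{a,\dots,b\}$ is an interval. $\mathcal{I}_k$ denotes the set of non-empty subsets of $[n]$ that are unions of at most $k$ intervals. $S^d = S \times\dots\times S\subset [n]^d$, and $\mathbbm{1}_X$ is the indicator function of $X$ on $[n]^d$. For $T \subset [n]$, $V(T)$ is the set of $x=(x_1,\dots,x_d) \in [n]^d$ such that $\{x_1,\dots,x_d\} = T$. -}

module Defs where

open import Data.Nat as ℕ using (ℕ; _≤ᵇ_)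
open import Data.Bool using (Bool; true; false; _∧_; _xor_)
open import Data.Fin using (Fin; toℕ)
open import Data.Fin.Subset using (Subset; _∈_; _∪_; ⊥; Nonempty)
open import Data.Fin.Subset.Properties using (_∈?_)
open import Data.Fin.Properties using (all?; any?)
open import Data.Vec using (tabulate)
open import Data.List using (List; foldr; map; length)
open import Data.List.Relation.Unary.All using (All)
open import Data.Product using (_×_; _,_; ∃; ∃-syntax; Σ)
open import Relation.Binary.PropositionalEquality using (_≡_)
open import Relation.Nullary.Decidable using (⌊_⌋; _×-dec_)

-- [n] is modelled by Fin n (0-indexed), subsets of [n] by Subset n,
-- points of [n]^d by functions Fin d → Fin n, and 𝔽₂ by Bool with xor as +.

F₂ : Set
F₂ = Bool

interval : ∀ {n} → Fin n → Fin n → Subset n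
interval a b = tabulate (λ i → (toℕ a ≤ᵇ toℕ i) ∧ (toℕ i ≤ᵇ toℕ b))

unionOfIntervals : ∀ {n} → List (Fin n × Fin n) → Subset n
unionOfIntervals = foldr (λ ab S → interval (Data.Product.proj₁ ab) (Data.Product.proj₂ ab) ∪ S) ⊥

InI : ∀ {n} (k : ℕ) → Subset n → Set
InI {n} k S =
  Nonempty S ×
  ∃[ L ] (All (λ ab → toℕ (Data.Product.proj₁ ab) ℕ.≤ toℕ (Data.Product.proj₂ ab)) L
          × length L ℕ.≤ k
          × S ≡ unionOfIntervals L)

indCube : ∀ {n} d → Subset n → (Fin d → Fin n) → F₂
indCube d S x = ⌊ all? (λ i → x i ∈? S) ⌋

InV : ∀ {n} d → Subset n → (Fin d → Fin n) → Set
InV d T x = (∀ i → x i ∈ T) × (∀ t → t ∈ T → ∃[ i ] x i ≡ t)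

indV : ∀ {n} d → Subset n → (Fin d → Fin n) → F₂
indV d T x = ⌊ all? (λ i → x i ∈? T) ×-dec all? (λ t → dec t) ⌋
  where
  open import Relation.Nullary using (Dec; yes; no)
  open import Data.Fin.Properties using (_≟_)
  open import Relation.Nullary.Decidable using (_→-dec_)
  dec : ∀ t → Dec (t ∈ T → ∃[ i ] x i ≡ t)
  dec t = (t ∈? T) →-dec any? (λ i → x i ≟ t)

-- f lies in the 𝔽₂-span of { 1_{S^d} : S ∈ 𝓘_k }: f is a finite sum (over 𝔽₂,
-- coefficients being 0 or 1) of such indicators
InSpanCubes : ∀ {n} (k d : ℕ) → ((Fin d → Fin n) → F₂) → Set
InSpanCubes {n} k d f =
  ∃[ L ] (All (InI k) L ×
          (∀ (x : Fin d → Fin n) → f x ≡ foldr (λ S acc → indCube d S x xor acc) false L))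

-- Write between Y Z for the indicator of the points x ∈ Z^d with Y ⊆ {x₁,…,x_d}, so that
-- 1_{V(T)} = between T T and 1_{S^d} = between ∅ S. Over 𝔽₂, inclusion–exclusion in one point reads
--   between (Y ∪ {t}) Z = between Y Z + between Y (Z ∖ {t}).
-- We show that every between Y Z lies in the span, by downward induction on |Y|. It vanishes when
-- |Y| > d (pigeonhole) or Y ⊄ Z. Otherwise, by the induction hypothesis applied to Y ∪ {t}, changing
-- Z at a single point t ∉ Y changes between Y Z by an element of the span; so between Y Z is congruent
-- to between Y X for any X ⊇ Y. Take for X the union of the intervals [y₁,y₂], [y₃,y₄], … formed by
-- the sorted elements of Y, at most k of them as |Y| ≤ 2k. Peeling y₁, y₂, … off the ends of these intervals with
-- the same identity writes between Y X as a sum of indicators of cubes over unions of ≤ k intervals.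
module Submission where

open import Defs
open import Data.Nat using (ℕ; _≤_; _*_)
open import Data.Fin.Subset using (Subset; ∣_∣)
open import Relation.Binary.PropositionalEquality using (_≡_)

open import Data.Nat using (zero; suc; _+_; _<_; _≤ᵇ_; _<ᵇ_; _≡ᵇ_; _≤?_; _<?_; z≤n; s≤s)
open import Data.Nat.Properties
  using (≤-refl; ≤-trans; ≤-reflexive; ≤-pred; <⇒≤; <⇒≢; <⇒≱; ≤⇒≯; ≤-<-trans; n<1+n; n≤1+n; m≤n⇒m≤1+n;
         m<n⇒m<1+n; m≤n+m; m≤m+n; +-suc; +-identityʳ; *-suc; <-cmp; ≤⇒≤ᵇ; ≤ᵇ⇒≤; <⇒<ᵇ; <ᵇ⇒<; ≡ᵇ⇒≡; ≡⇒≡ᵇ)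
  renaming (_≟_ to _≟ℕ_)
open import Data.Bool.Base using (Bool; true; false; T; not; _∧_; _∨_; _xor_; if_then_else_)
open import Data.Bool.Properties
  using (T?; T-≡; T-∧; T-∨; ∧-zeroʳ; ∧-identityʳ; ∧-comm; ∧-assoc; ∧-distribʳ-∨; ∨-assoc; ∨-conicalˡ;
         ∨-conicalʳ; xor-same; xor-identityʳ; xor-assoc)
  renaming (_≟_ to _≟ᵇ_)
open import Data.Bool.ListAction using (and; all; any)
open import Data.Bool.Solver using (module xor-∧-Solver)
open import Data.Empty using (⊥-elim)
open import Data.Sum using (inj₁; inj₂)
open import Data.Product using (_×_; _,_; ∃-syntax; proj₁; proj₂)
open import Data.Fin using (Fin; toℕ; fromℕ<)
open import Data.Fin.Properties using (toℕ<n; toℕ-fromℕ<; toℕ-injective; injective⇒≤)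
open import Data.Fin.Subset using (⊥; _∪_) renaming (_∈_ to _∈ₛ_)
open import Data.Fin.Subset.Properties using (nonempty?)
open import Data.Vec using ([]; _∷_; lookup; here; there)
open import Data.Vec.Properties using (lookup∘tabulate)
open import Data.List using (List; []; _∷_; [_]; _++_; length; filter; upTo; allFin; foldr)
open import Data.List.Properties using (++-assoc; length-++; map-cong)
open import Data.List.Membership.Propositional using (_∈_; _∉_; lose)
open import Data.List.Membership.Propositional.Properties
  using (∈-allFin; ∈-lookup; ∈-filter⁺; ∈-filter⁻; ∈-upTo⁺; ∈-upTo⁻)
open import Data.List.Membership.DecPropositional _≟ℕ_ using (_∈?_)
open import Data.List.Relation.Unary.All as All using (All; []; _∷_)
open import Data.List.Relation.Unary.All.Properties using (all⁺; all⁻; all-anti-mono; ++⁺; ¬Any⇒All¬)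
open import Data.List.Relation.Unary.Any using (satisfied)
open import Data.List.Relation.Unary.Any.Properties using (any⁺; any⁻)
open import Data.List.Relation.Unary.AllPairs as AllPairs using (AllPairs; []; _∷_)
import Data.List.Relation.Unary.AllPairs.Properties as AllPairs
open import Data.List.Relation.Unary.Unique.Propositional using (Unique)
open import Function using (_∘_; Equivalence)
open import Relation.Binary.PropositionalEquality
  using (_≢_; _≗_; refl; sym; trans; cong; cong₂; subst; subst₂; module ≡-Reasoning)
open import Relation.Binary.Definitions using (tri<; tri≈; tri>)
open import Relation.Nullary using (¬_; Dec; yes; no)
open import Relation.Nullary.Decidable using (⌊_⌋)
open import Relation.Unary using (Decidable)

open Equivalence using (to; from)

¬T⇒≡false : ∀ {b} → ¬ T b → b ≡ false
¬T⇒≡false {false} _ = refl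
¬T⇒≡false {true} ¬t = ⊥-elim (¬t _)

T-ext : ∀ {a b} → (T a → T b) → (T b → T a) → a ≡ b
T-ext {false} {false} _ _ = refl
T-ext {false} {true} _ b⇒a = ⊥-elim (b⇒a _)
T-ext {true} {false} a⇒b _ = ⊥-elim (a⇒b _)
T-ext {true} {true} _ _ = refl

T-∨ˡ : ∀ {a} b → T a → T (a ∨ b)
T-∨ˡ b = from T-∨ ∘ inj₁

T-∨ʳ : ∀ a {b} → T b → T (a ∨ b)
T-∨ʳ a = from (T-∨ {a}) ∘ inj₂

⌊⌋-≡ : ∀ {P : Set} {b} (p? : Dec P) → (P → T b) → (T b → P) → ⌊ p? ⌋ ≡ b
⌊⌋-≡ {b = false} (yes p) P⇒b _ = ⊥-elim (P⇒b p)
⌊⌋-≡ {b = false} (no _) _ _ = refl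
⌊⌋-≡ {b = true} (yes _) _ _ = refl
⌊⌋-≡ {b = true} (no ¬p) _ b⇒P = ⊥-elim (¬p (b⇒P _))

module _ where
  open xor-∧-Solver

  xor-cancelˡ : ∀ a b → a xor (a xor b) ≡ b
  xor-cancelˡ = solve 2 (λ a b → a :+ (a :+ b) := b) refl

  xor-cancelʳ : ∀ a b c → (a xor c) xor (b xor c) ≡ a xor b
  xor-cancelʳ = solve 3 (λ a b c → (a :+ c) :+ (b :+ c) := a :+ b) refl

  xor-cancel-middle : ∀ a b c → (a xor b) xor (b xor c) ≡ a xor c
  xor-cancel-middle = solve 3 (λ a b c → (a :+ b) :+ (b :+ c) := a :+ c) refl

all-∧-not : ∀ {A : Set} (p q : A → Bool) xs → all (λ a → p a ∧ not (q a)) xs ≡ all p xs ∧ not (any q xs)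
all-∧-not p q [] = refl
all-∧-not p q (x ∷ xs) = trans (cong ((p x ∧ not (q x)) ∧_) (all-∧-not p q xs)) (regroup (p x) (q x) _ _)
  where
  regroup : ∀ a b c e → (a ∧ not b) ∧ (c ∧ not e) ≡ (a ∧ c) ∧ not (b ∨ e)
  regroup false _ _ _ = refl
  regroup true true c _ = sym (∧-zeroʳ c)
  regroup true false _ _ = refl

Unique-lookup-injective : ∀ {A : Set} {xs : List A} → Unique xs →
                          ∀ {i j} → Data.List.lookup xs i ≡ Data.List.lookup xs j → i ≡ j
Unique-lookup-injective (_ ∷ _) {Fin.zero} {Fin.zero} _ = refl
Unique-lookup-injective (x≢xs ∷ _) {Fin.zero} {Fin.suc j} eq = ⊥-elim (All.lookup x≢xs (∈-lookup j) eq)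
Unique-lookup-injective (x≢xs ∷ _) {Fin.suc i} {Fin.zero} eq = ⊥-elim (All.lookup x≢xs (∈-lookup i) (sym eq))
Unique-lookup-injective (_ ∷ xs-unique) {Fin.suc i} {Fin.suc j} eq = cong Fin.suc (Unique-lookup-injective xs-unique eq)

module _ {P : ℕ → Set} (P? : Decidable P) (n : ℕ) where

  filter-upTo-sorted : AllPairs _<_ (filter P? (upTo n))
  filter-upTo-sorted = AllPairs.filter⁺ P? (AllPairs.applyUpTo⁺₁ (λ i → i) n (λ i<j _ → i<j))

  filter-upTo-bounded : All (_< n) (filter P? (upTo n))
  filter-upTo-bounded = All.tabulate (λ p∈ → ∈-upTo⁻ (proj₁ (∈-filter⁻ P? p∈)))

-- Sets of naturals and intervals

-- All sets below are Boolean predicates on ℕ, so that interval endpoints can be shifted freely;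
-- χ S reads a subset S of [n] (0-indexed) as such a predicate, false from n on.
χ : ∀ {m} → Subset m → ℕ → Bool
χ [] _ = false
χ (b ∷ S) zero = b
χ (b ∷ S) (suc p) = χ S p

χ-toℕ : ∀ {m} (S : Subset m) p → χ S (toℕ p) ≡ lookup S p
χ-toℕ (b ∷ S) Fin.zero = refl
χ-toℕ (b ∷ S) (Fin.suc p) = χ-toℕ S p

∈⇒χ : ∀ {m} {S : Subset m} {p} → p ∈ₛ S → T (χ S (toℕ p))
∈⇒χ here = _
∈⇒χ (there p∈S) = ∈⇒χ p∈S

χ⇒∈ : ∀ {m} (S : Subset m) p → T (χ S (toℕ p)) → p ∈ₛ S
χ⇒∈ (true ∷ S) Fin.zero _ = here
χ⇒∈ (b ∷ S) (Fin.suc p) t = there (χ⇒∈ S p t)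

χ-∪ : ∀ {m} (S S′ : Subset m) p → χ (S ∪ S′) p ≡ χ S p ∨ χ S′ p
χ-∪ [] [] p = refl
χ-∪ (b ∷ S) (b′ ∷ S′) zero = refl
χ-∪ (b ∷ S) (b′ ∷ S′) (suc p) = χ-∪ S S′ p

χ-⊥ : ∀ {m} p → χ (⊥ {m}) p ≡ false
χ-⊥ {zero} p = refl
χ-⊥ {suc m} zero = refl
χ-⊥ {suc m} (suc p) = χ-⊥ {m} p

_∖_ : (ℕ → Bool) → ℕ → ℕ → Bool
(Z ∖ t) p = Z p ∧ not (p ≡ᵇ t)

∖-fresh : ∀ {Z t} → Z t ≡ false → Z ∖ t ≗ Z
∖-fresh {Z} {t} Zt≡false p with p ≡ᵇ t in p≡ᵇt
... | false = ∧-identityʳ (Z p)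
... | true = trans (∧-zeroʳ (Z p)) (sym (trans (cong Z (≡ᵇ⇒≡ p t (from T-≡ p≡ᵇt))) Zt≡false))

⟦_⟧ : ℕ × ℕ → ℕ → Bool
⟦ a , b ⟧ p = (a ≤ᵇ p) ∧ (p ≤ᵇ b)

⟦⟧-∋ : ∀ {a b p} → a ≤ p → p ≤ b → T (⟦ a , b ⟧ p)
⟦⟧-∋ a≤p p≤b = from T-∧ (≤⇒≤ᵇ a≤p , ≤⇒≤ᵇ p≤b)

⟦⟧-∌ : ∀ {a b p} → ¬ (a ≤ p × p ≤ b) → ⟦ a , b ⟧ p ≡ false
⟦⟧-∌ {a} {b} {p} p∉ = ¬T⇒≡false λ t →
  let (a≤ᵇp , p≤ᵇb) = to T-∧ t in p∉ (≤ᵇ⇒≤ a p a≤ᵇp , ≤ᵇ⇒≤ p b p≤ᵇb)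

<ᵇ-suc : ∀ m n → (m <ᵇ suc n) ≡ (m ≤ᵇ n)
<ᵇ-suc zero n = refl
<ᵇ-suc (suc m) n = refl

≡ᵇ-comm : ∀ m n → (m ≡ᵇ n) ≡ (n ≡ᵇ m)
≡ᵇ-comm zero zero = refl
≡ᵇ-comm zero (suc n) = refl
≡ᵇ-comm (suc m) zero = refl
≡ᵇ-comm (suc m) (suc n) = ≡ᵇ-comm m n

≤ᵇ-∧-≢ᵇ : ∀ m n → (m ≤ᵇ n) ∧ not (n ≡ᵇ m) ≡ (m <ᵇ n)
≤ᵇ-∧-≢ᵇ zero zero = refl
≤ᵇ-∧-≢ᵇ zero (suc n) = refl
≤ᵇ-∧-≢ᵇ (suc m) zero = refl
≤ᵇ-∧-≢ᵇ (suc m) (suc n) rewrite <ᵇ-suc m n = ≤ᵇ-∧-≢ᵇ m n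

⟦⟧-∖-lower : ∀ a b → ⟦ a , b ⟧ ∖ a ≗ ⟦ suc a , b ⟧
⟦⟧-∖-lower a b p = begin
  ((a ≤ᵇ p) ∧ (p ≤ᵇ b)) ∧ not (p ≡ᵇ a)   ≡⟨ ∧-assoc (a ≤ᵇ p) _ _ ⟩
  (a ≤ᵇ p) ∧ ((p ≤ᵇ b) ∧ not (p ≡ᵇ a))   ≡⟨ cong ((a ≤ᵇ p) ∧_) (∧-comm (p ≤ᵇ b) _) ⟩
  (a ≤ᵇ p) ∧ (not (p ≡ᵇ a) ∧ (p ≤ᵇ b))   ≡⟨ sym (∧-assoc (a ≤ᵇ p) _ _) ⟩
  ((a ≤ᵇ p) ∧ not (p ≡ᵇ a)) ∧ (p ≤ᵇ b)   ≡⟨ cong (_∧ (p ≤ᵇ b)) (≤ᵇ-∧-≢ᵇ a p) ⟩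
  (a <ᵇ p) ∧ (p ≤ᵇ b)                     ∎
  where open ≡-Reasoning

⟦⟧-∖-upper : ∀ a b → ⟦ a , suc b ⟧ ∖ suc b ≗ ⟦ a , b ⟧
⟦⟧-∖-upper a b p = trans (∧-assoc (a ≤ᵇ p) _ _) (cong ((a ≤ᵇ p) ∧_) (upper p))
  where
  upper : ∀ p → (p ≤ᵇ suc b) ∧ not (p ≡ᵇ suc b) ≡ (p ≤ᵇ b)
  upper zero = refl
  upper (suc p) rewrite <ᵇ-suc p b | ≡ᵇ-comm p b = ≤ᵇ-∧-≢ᵇ p b

⋃ : List (ℕ × ℕ) → ℕ → Bool
⋃ J p = any (λ I → ⟦ I ⟧ p) J

⋃-++ : ∀ J K p → ⋃ (J ++ K) p ≡ ⋃ J p ∨ ⋃ K p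
⋃-++ [] K p = refl
⋃-++ (I ∷ J) K p = trans (cong (⟦ I ⟧ p ∨_) (⋃-++ J K p)) (sym (∨-assoc (⟦ I ⟧ p) _ _))

⋃-∖ : ∀ {t} J {K I I′} → ⋃ J t ≡ false → ⋃ K t ≡ false → ⟦ I ⟧ ∖ t ≗ ⟦ I′ ⟧ →
      ⋃ (J ++ I ∷ K) ∖ t ≗ ⋃ (J ++ I′ ∷ K)
⋃-∖ {t} [] {K} {I} _ K∌t I∖t≗I′ p =
  trans (∧-distribʳ-∨ (not (p ≡ᵇ t)) (⟦ I ⟧ p) (⋃ K p)) (cong₂ _∨_ (I∖t≗I′ p) (∖-fresh {⋃ K} {t} K∌t p))
⋃-∖ {t} (I₀ ∷ J) {K} {I} J∌t K∌t I∖t≗I′ p =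
  trans (∧-distribʳ-∨ (not (p ≡ᵇ t)) (⟦ I₀ ⟧ p) (⋃ (J ++ I ∷ K) p))
        (cong₂ _∨_ (∖-fresh {⟦ I₀ ⟧} {t} (∨-conicalˡ _ _ J∌t) p) (⋃-∖ J (∨-conicalʳ _ _ J∌t) K∌t I∖t≗I′ p))

length-++-∷ : ∀ {A : Set} (J : List A) {I I′ K} → length (J ++ I ∷ K) ≡ length (J ++ I′ ∷ K)
length-++-∷ J = trans (length-++ J) (sym (length-++ J))

cover : List ℕ → List (ℕ × ℕ)
cover [] = []
cover (y ∷ []) = (y , y) ∷ []
cover (a ∷ b ∷ Y) = (a , b) ∷ cover Y

length-cover : ∀ Y {k} → length Y ≤ 2 * k → length (cover Y) ≤ k
length-cover [] _ = z≤n
length-cover (y ∷ []) {suc k} _ = s≤s z≤n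
length-cover (a ∷ b ∷ Y) {suc k} Y≤2k =
  s≤s (length-cover Y (≤-pred (≤-pred (subst (length (a ∷ b ∷ Y) ≤_) (*-suc 2 k) Y≤2k))))

⋃-cover-∋ : ∀ {Y} → AllPairs _<_ Y → All (λ y → T (⋃ (cover Y) y)) Y
⋃-cover-∋ [] = []
⋃-cover-∋ {y ∷ []} (_ ∷ []) = T-∨ˡ false (⟦⟧-∋ {y} ≤-refl ≤-refl) ∷ []
⋃-cover-∋ {a ∷ b ∷ Y} ((a<b ∷ _) ∷ _ ∷ Y-sorted) =
  T-∨ˡ (⋃ (cover Y) a) (⟦⟧-∋ {a} ≤-refl (<⇒≤ a<b)) ∷ T-∨ˡ (⋃ (cover Y) b) (⟦⟧-∋ (<⇒≤ a<b) ≤-refl) ∷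
  All.map (T-∨ʳ (⟦ a , b ⟧ _)) (⋃-cover-∋ Y-sorted)

⋃-cover-below : ∀ {lo Y p} → All (lo ≤_) Y → p < lo → ⋃ (cover Y) p ≡ false
⋃-cover-below [] _ = refl
⋃-cover-below (lo≤y ∷ []) p<lo = cong (_∨ false) (⟦⟧-∌ λ (y≤p , _) → <⇒≱ p<lo (≤-trans lo≤y y≤p))
⋃-cover-below (lo≤a ∷ _ ∷ lo≤Y) p<lo =
  cong₂ _∨_ (⟦⟧-∌ λ (a≤p , _) → <⇒≱ p<lo (≤-trans lo≤a a≤p)) (⋃-cover-below lo≤Y p<lo)

-- Points, cubes and the span

module Cubes (n d k : ℕ) where

  Point : Set
  Point = Fin d → Fin n

  data Span : (Point → Bool) → Set where
    nil : Span (λ _ → false)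
    gen : ∀ {S} → InI k S → Span (indCube d S)
    _⊕_ : ∀ {f g} → Span f → Span g → Span (λ x → f x xor g x)
    resp : ∀ {f g} → Span f → f ≗ g → Span g

  cubeSum : List (Subset n) → Point → Bool
  cubeSum L x = foldr (λ S acc → indCube d S x xor acc) false L

  cubeSum-++ : ∀ L L′ x → cubeSum (L ++ L′) x ≡ cubeSum L x xor cubeSum L′ x
  cubeSum-++ [] L′ x = refl
  cubeSum-++ (S ∷ L) L′ x = trans (cong (indCube d S x xor_) (cubeSum-++ L L′ x))
                                  (sym (xor-assoc (indCube d S x) (cubeSum L x) (cubeSum L′ x)))

  Span⇒InSpanCubes : ∀ {f} → Span f → InSpanCubes k d f
  Span⇒InSpanCubes nil = [] , [] , λ _ → refl
  Span⇒InSpanCubes (gen {S} S∈𝓘) = [ S ] , S∈𝓘 ∷ [] , λ x → sym (xor-identityʳ _)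
  Span⇒InSpanCubes (s ⊕ s′) with Span⇒InSpanCubes s | Span⇒InSpanCubes s′
  ... | L , L∈𝓘 , f≡ | L′ , L′∈𝓘 , g≡ =
    L ++ L′ , ++⁺ L∈𝓘 L′∈𝓘 , λ x → trans (cong₂ _xor_ (f≡ x) (g≡ x)) (sym (cubeSum-++ L L′ x))
  Span⇒InSpanCubes (resp s f≗g) with Span⇒InSpanCubes s
  ... | L , L∈𝓘 , f≡ = L , L∈𝓘 , λ x → trans (sym (f≗g x)) (f≡ x)

  Span-null : ∀ {f} → (∀ x → ¬ T (f x)) → Span f
  Span-null f≢true = resp nil (λ x → sym (¬T⇒≡false (f≢true x)))

  record _∼_ (f g : Point → Bool) : Set where
    constructor mk∼
    field difference : Span (λ x → f x xor g x)

  ≗⇒∼ : ∀ {f g} → f ≗ g → f ∼ g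
  ≗⇒∼ {f} f≗g = mk∼ (resp nil (λ x → sym (trans (cong (f x xor_) (sym (f≗g x))) (xor-same (f x)))))

  ∼-trans : ∀ {f g h} → f ∼ g → g ∼ h → f ∼ h
  ∼-trans {f} {g} {h} (mk∼ s) (mk∼ s′) = mk∼ (resp (s ⊕ s′) (λ x → xor-cancel-middle (f x) (g x) (h x)))

  Span-resp-∼ : ∀ {f g} → Span f → f ∼ g → Span g
  Span-resp-∼ {f} {g} s (mk∼ s′) = resp (s ⊕ s′) (λ x → xor-cancelˡ (f x) (g x))

  cube : (ℕ → Bool) → Point → Bool
  cube Z x = all (λ i → Z (toℕ (x i))) (allFin d)

  hits : ℕ → Point → Bool
  hits y x = any (λ i → toℕ (x i) ≡ᵇ y) (allFin d)

  covers : List ℕ → Point → Bool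
  covers Y x = all (λ y → hits y x) Y

  between : List ℕ → (ℕ → Bool) → Point → Bool
  between Y Z x = cube Z x ∧ covers Y x

  _≐_ : (ℕ → Bool) → (ℕ → Bool) → Set
  W ≐ W′ = ∀ (p : Fin n) → W (toℕ p) ≡ W′ (toℕ p)

  T-cube⇒ : ∀ Z x → T (cube Z x) → ∀ i → T (Z (toℕ (x i)))
  T-cube⇒ Z x t i = All.lookup (all⁺ (λ i → Z (toℕ (x i))) (allFin d) t) (∈-allFin i)

  T-cube⇐ : ∀ Z x → (∀ i → T (Z (toℕ (x i)))) → T (cube Z x)
  T-cube⇐ Z x h = all⁻ (λ i → Z (toℕ (x i))) {xs = allFin d} (All.tabulate (λ {i} _ → h i))

  T-covers⇒ : ∀ Y x → T (covers Y x) → ∀ {y} → y ∈ Y → ∃[ i ] toℕ (x i) ≡ y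
  T-covers⇒ Y x t {y} y∈Y =
    let (i , xᵢ≡ᵇy) = satisfied (any⁻ _ (allFin d) (All.lookup (all⁺ (λ y → hits y x) Y t) y∈Y))
    in i , ≡ᵇ⇒≡ _ y xᵢ≡ᵇy

  T-covers⇐ : ∀ Y x → (∀ {y} → y ∈ Y → ∃[ i ] toℕ (x i) ≡ y) → T (covers Y x)
  T-covers⇐ Y x h = all⁻ (λ y → hits y x) (All.tabulate λ {y} y∈Y →
    let (i , xᵢ≡y) = h y∈Y in any⁺ (λ i → toℕ (x i) ≡ᵇ y) (lose (∈-allFin i) (≡⇒≡ᵇ _ y xᵢ≡y)))

  T-between⇒ : ∀ Y Z x → T (between Y Z x) → T (cube Z x) × T (covers Y x)
  T-between⇒ Y Z x = to (T-∧ {cube Z x})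

  cube-cong : ∀ W W′ → W ≐ W′ → cube W ≗ cube W′
  cube-cong W W′ W≐W′ x = cong and (map-cong (W≐W′ ∘ x) (allFin d))

  between-cong : ∀ Y W W′ → W ≐ W′ → between Y W ≗ between Y W′
  between-cong Y W W′ W≐W′ x = cong (_∧ covers Y x) (cube-cong W W′ W≐W′ x)

  indCube≗cube : ∀ S → indCube d S ≗ cube (χ S)
  indCube≗cube S x = ⌊⌋-≡ _ (λ x∈S → T-cube⇐ (χ S) x (∈⇒χ ∘ x∈S)) (λ t i → χ⇒∈ S (x i) (T-cube⇒ (χ S) x t i))

  between⇒⊆ : ∀ {Y Z} x → T (between Y Z x) → All (T ∘ Z) Y
  between⇒⊆ {Y} {Z} x t = All.tabulate λ y∈Y →
    let (in-cube , Y-hit) = T-between⇒ Y Z x t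
        (i , xᵢ≡y) = T-covers⇒ Y x Y-hit y∈Y
    in subst (T ∘ Z) xᵢ≡y (T-cube⇒ Z x in-cube i)

  between⇒length≤ : ∀ {Y} Z x → Unique Y → T (between Y Z x) → length Y ≤ d
  between⇒length≤ {Y} Z x Y-unique t = injective⇒≤ {f = proj₁ ∘ hit} index-injective
    where
    hit : ∀ j → ∃[ i ] toℕ (x i) ≡ Data.List.lookup Y j
    hit j = T-covers⇒ Y x (proj₂ (T-between⇒ Y Z x t)) (∈-lookup j)
    index-injective : ∀ {j j′} → proj₁ (hit j) ≡ proj₁ (hit j′) → j ≡ j′
    index-injective {j} {j′} eq =
      Unique-lookup-injective Y-unique (trans (sym (proj₂ (hit j))) (trans (cong (toℕ ∘ x) eq) (proj₂ (hit j′))))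

  between-∷ : ∀ t Y Z x → between (t ∷ Y) Z x ≡ between Y Z x xor between Y (Z ∖ t) x
  between-∷ t Y Z x rewrite all-∧-not (λ i → Z (toℕ (x i))) (λ i → toℕ (x i) ≡ᵇ t) (allFin d) =
    split (cube Z x) (hits t x) (covers Y x)
    where
    split : ∀ c h C → c ∧ (h ∧ C) ≡ (c ∧ C) xor ((c ∧ not h) ∧ C)
    split false _ _ = refl
    split true true C = sym (xor-identityʳ C)
    split true false C = sym (xor-same C)

  between-[]-span : ∀ Z → Span (cube Z) → Span (between [] Z)
  between-[]-span Z s = resp s (λ x → sym (∧-identityʳ (cube Z x)))

  between-∷-span : ∀ t Y Z → Span (between Y Z) → Span (between Y (Z ∖ t)) → Span (between (t ∷ Y) Z)
  between-∷-span t Y Z s s′ = resp (s ⊕ s′) (λ x → sym (between-∷ t Y Z x))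

  between-exchange : ∀ t Y W W′ → (∀ p → p ≢ t → W p ≡ W′ p) →
                     Span (between (t ∷ Y) W) → Span (between (t ∷ Y) W′) → between Y W ∼ between Y W′
  between-exchange t Y W W′ W≡W′ s s′ = mk∼ (resp (s ⊕ s′) λ x → begin
    between (t ∷ Y) W x xor between (t ∷ Y) W′ x
      ≡⟨ cong₂ _xor_ (between-∷ t Y W x) (between-∷ t Y W′ x) ⟩
    (between Y W x xor between Y (W ∖ t) x) xor (between Y W′ x xor between Y (W′ ∖ t) x)
      ≡⟨ cong (λ b → (between Y W x xor between Y (W ∖ t) x) xor (between Y W′ x xor b))
              (sym (between-cong Y (W ∖ t) (W′ ∖ t) (W∖t≗W′∖t ∘ toℕ) x)) ⟩
    (between Y W x xor between Y (W ∖ t) x) xor (between Y W′ x xor between Y (W ∖ t) x)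
      ≡⟨ xor-cancelʳ (between Y W x) (between Y W′ x) (between Y (W ∖ t) x) ⟩
    between Y W x xor between Y W′ x ∎)
    where
    open ≡-Reasoning
    W∖t≗W′∖t : W ∖ t ≗ W′ ∖ t
    W∖t≗W′∖t p with p ≡ᵇ t in p≡ᵇt
    ... | true = trans (∧-zeroʳ (W p)) (sym (∧-zeroʳ (W′ p)))
    ... | false = cong (_∧ true) (W≡W′ p (λ p≡t → subst T p≡ᵇt (≡⇒≡ᵇ p t p≡t)))

  module _ (F : (ℕ → Bool) → Point → Bool) (F-cong : ∀ W W′ → W ≐ W′ → F W ≗ F W′) where

    pointwise-steps⇒∼ : ∀ Z₁ Z₂ →
      (∀ j → j < n → Z₁ j ≢ Z₂ j → ∀ W W′ → (∀ p → p ≢ j → W p ≡ W′ p) → F W ∼ F W′) → F Z₁ ∼ F Z₂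
    pointwise-steps⇒∼ Z₁ Z₂ step =
      ∼-trans (steps n) (≗⇒∼ (F-cong (hybrid n) Z₂ (λ p → hybrid-below (toℕ<n p))))
      where
      hybrid : ℕ → ℕ → Bool
      hybrid j p = if p <ᵇ j then Z₂ p else Z₁ p

      hybrid-below : ∀ {j p} → p < j → hybrid j p ≡ Z₂ p
      hybrid-below {j} {p} p<j = cong (if_then Z₂ p else Z₁ p) (to T-≡ (<⇒<ᵇ p<j))

      hybrid-above : ∀ {j p} → j ≤ p → hybrid j p ≡ Z₁ p
      hybrid-above {j} {p} j≤p = cong (if_then Z₂ p else Z₁ p) (¬T⇒≡false (≤⇒≯ j≤p ∘ <ᵇ⇒< p j))

      hybrid-suc : ∀ j p → (p ≡ j → Z₁ j ≡ Z₂ j) → hybrid (suc j) p ≡ hybrid j p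
      hybrid-suc j p agree with <-cmp p j
      ... | tri< p<j _ _ = trans (hybrid-below (m<n⇒m<1+n p<j)) (sym (hybrid-below p<j))
      ... | tri≈ _ refl _ = trans (hybrid-below (n<1+n p)) (trans (sym (agree refl)) (sym (hybrid-above ≤-refl)))
      ... | tri> _ _ j<p = trans (hybrid-above j<p) (sym (hybrid-above (<⇒≤ j<p)))

      hybrid-suc-≐ : ∀ j → (j < n → Z₁ j ≡ Z₂ j) → hybrid j ≐ hybrid (suc j)
      hybrid-suc-≐ j agree p = sym (hybrid-suc j (toℕ p) (λ p≡j → agree (subst (_< n) p≡j (toℕ<n p))))

      step-at : ∀ j → F (hybrid j) ∼ F (hybrid (suc j))
      step-at j with j <? n | Z₁ j ≟ᵇ Z₂ j
      ... | yes j<n | no Z₁j≢Z₂j =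
        step j j<n Z₁j≢Z₂j (hybrid j) (hybrid (suc j)) (λ p p≢j → sym (hybrid-suc j p (⊥-elim ∘ p≢j)))
      ... | yes _ | yes Z₁j≡Z₂j = ≗⇒∼ (F-cong _ _ (hybrid-suc-≐ j (λ _ → Z₁j≡Z₂j)))
      ... | no j≮n | _ = ≗⇒∼ (F-cong _ _ (hybrid-suc-≐ j (⊥-elim ∘ j≮n)))

      steps : ∀ j → F Z₁ ∼ F (hybrid j)
      steps zero = ≗⇒∼ (λ _ → refl)
      steps (suc j) = ∼-trans (steps j) (step-at j)

  -- Cubes over unions of intervals

  χ-interval : ∀ (a b p : Fin n) → χ (interval a b) (toℕ p) ≡ ⟦ toℕ a , toℕ b ⟧ (toℕ p)
  χ-interval a b p = trans (χ-toℕ (interval a b) p) (lookup∘tabulate (λ i → (toℕ a ≤ᵇ toℕ i) ∧ (toℕ i ≤ᵇ toℕ b)) p)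

  ⋃⇒unionOfIntervals : ∀ J → All (λ I → proj₂ I < n) J →
    ∃[ L ] All (λ I → toℕ (proj₁ I) ≤ toℕ (proj₂ I)) L × length L ≤ length J × χ (unionOfIntervals L) ≐ ⋃ J
  ⋃⇒unionOfIntervals [] [] = [] , [] , z≤n , λ p → χ-⊥ {n} (toℕ p)
  ⋃⇒unionOfIntervals ((a , b) ∷ J) (b<n ∷ J<n) with ⋃⇒unionOfIntervals J J<n | a ≤? b
  ... | L , L-ordered , L≤J , L≐J | no a≰b =
    L , L-ordered , m≤n⇒m≤1+n L≤J ,
    λ p → trans (L≐J p) (cong (_∨ ⋃ J (toℕ p)) (sym (⟦⟧-∌ λ (a≤p , p≤b) → a≰b (≤-trans a≤p p≤b))))
  ... | L , L-ordered , L≤J , L≐J | yes a≤b =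
    (a′ , b′) ∷ L , subst₂ _≤_ (sym a′≡a) (sym b′≡b) a≤b ∷ L-ordered , s≤s L≤J ,
    λ p → trans (χ-∪ (interval a′ b′) (unionOfIntervals L) (toℕ p))
                (cong₂ _∨_ (trans (χ-interval a′ b′ p) (cong₂ (λ u v → ⟦ u , v ⟧ (toℕ p)) a′≡a b′≡b)) (L≐J p))
    where
    a<n = ≤-<-trans a≤b b<n
    a′ b′ : Fin n
    a′ = fromℕ< a<n
    b′ = fromℕ< b<n
    a′≡a = toℕ-fromℕ< a<n
    b′≡b = toℕ-fromℕ< b<n

  cube-⋃-span : 1 ≤ d → ∀ J → All (λ I → proj₂ I < n) J → length J ≤ k → Span (cube (⋃ J))
  cube-⋃-span 1≤d J J<n J≤k with ⋃⇒unionOfIntervals J J<n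
  ... | L , L-ordered , L≤J , L≐J with nonempty? (unionOfIntervals L)
  ...   | yes nonempty =
    resp (gen (nonempty , L , L-ordered , ≤-trans L≤J J≤k , refl))
         (λ x → trans (indCube≗cube _ x) (cube-cong (χ (unionOfIntervals L)) (⋃ J) L≐J x))
  ...   | no empty = Span-null λ x t →
    let i₀ = fromℕ< 1≤d in
    empty (x i₀ , χ⇒∈ _ (x i₀) (subst T (sym (L≐J (x i₀))) (T-cube⇒ (⋃ J) x t i₀)))

  between-∷-shrink : ∀ t Y J K I I′ → ⋃ J t ≡ false → ⋃ K t ≡ false → ⟦ I ⟧ ∖ t ≗ ⟦ I′ ⟧ →
    Span (between Y (⋃ (J ++ I ∷ K))) → Span (between Y (⋃ (J ++ I′ ∷ K))) →
    Span (between (t ∷ Y) (⋃ (J ++ I ∷ K)))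
  between-∷-shrink t Y J K I I′ J∌t K∌t I∖t≗I′ s s′ = between-∷-span t Y (⋃ (J ++ I ∷ K)) s
    (resp s′ (between-cong Y (⋃ (J ++ I′ ∷ K)) (⋃ (J ++ I ∷ K) ∖ t) (λ p → sym (⋃-∖ J J∌t K∌t I∖t≗I′ (toℕ p)))))

  -- J collects the intervals already shrunk; since Y avoids ⋃ J, removing a point of Y only
  -- affects the interval of cover Y that contains it.
  between-⋃-++-cover-span : 1 ≤ d → ∀ {Y} → AllPairs _<_ Y → All (_< n) Y →
    ∀ J → All (λ I → proj₂ I < n) J → All (λ y → ⋃ J y ≡ false) Y → length (J ++ cover Y) ≤ k →
    Span (between Y (⋃ (J ++ cover Y)))
  between-⋃-++-cover-span 1≤d {[]} _ _ J J<n _ J≤k =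
    between-[]-span (⋃ (J ++ [])) (cube-⋃-span 1≤d (J ++ []) (++⁺ J<n []) J≤k)
  between-⋃-++-cover-span 1≤d {y ∷ []} _ (y<n ∷ []) J J<n (J∌y ∷ []) J≤k =
    between-∷-shrink y [] J [] (y , y) (suc y , y) J∌y refl (⟦⟧-∖-lower y y) (starting-at y) (starting-at (suc y))
    where
    starting-at : ∀ a → Span (between [] (⋃ (J ++ (a , y) ∷ [])))
    starting-at a = between-[]-span (⋃ (J ++ (a , y) ∷ []))
      (cube-⋃-span 1≤d _ (++⁺ J<n (y<n ∷ [])) (≤-trans (≤-reflexive (length-++-∷ J {a , y} {y , y} {[]})) J≤k))
  between-⋃-++-cover-span 1≤d {a ∷ zero ∷ Y} ((() ∷ _) ∷ _) _ _ _ _ _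
  between-⋃-++-cover-span 1≤d {a ∷ suc b ∷ Y} ((a<1+b ∷ _) ∷ 1+b<Y ∷ Y-sorted) (_ ∷ 1+b<n ∷ Y<n)
                          J J<n (J∌a ∷ J∌1+b ∷ J∌Y) J≤k =
    between-∷-shrink a (suc b ∷ Y) J (cover Y) (a , suc b) (suc a , suc b) J∌a (C∌ (<⇒≤ a<1+b))
      (⟦⟧-∖-lower a (suc b)) (shrink-upper a) (shrink-upper (suc a))
    where
    C∌ : ∀ {p} → p ≤ suc b → ⋃ (cover Y) p ≡ false
    C∌ p≤1+b = ⋃-cover-below 1+b<Y (s≤s p≤1+b)

    rest : ∀ a′ b′ → b′ ≤ suc b → Span (between Y (⋃ (J ++ (a′ , b′) ∷ cover Y)))
    rest a′ b′ b′≤1+b = subst (λ L → Span (between Y (⋃ L))) (++-assoc J [ (a′ , b′) ] (cover Y))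
      (between-⋃-++-cover-span 1≤d Y-sorted Y<n (J ++ [ (a′ , b′) ]) (++⁺ J<n (≤-<-trans b′≤1+b 1+b<n ∷ []))
        (All.zipWith (λ {y} (J∌y , 1+b<y) → trans (⋃-++ J [ (a′ , b′) ] y)
                        (cong₂ _∨_ J∌y (cong (_∨ false) (⟦⟧-∌ {a′} λ (_ , y≤b′) → <⇒≱ 1+b<y (≤-trans y≤b′ b′≤1+b)))))
                     (J∌Y , 1+b<Y))
        (subst (_≤ k) (cong length (sym (++-assoc J _ _))) (≤-trans (≤-reflexive (length-++-∷ J)) J≤k)))

    shrink-upper : ∀ a′ → Span (between (suc b ∷ Y) (⋃ (J ++ (a′ , suc b) ∷ cover Y)))
    shrink-upper a′ = between-∷-shrink (suc b) Y J (cover Y) (a′ , suc b) (a′ , b) J∌1+b (C∌ ≤-refl)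
      (⟦⟧-∖-upper a′ b) (rest a′ (suc b) ≤-refl) (rest a′ b (n≤1+n b))

  between-⋃-cover-span : 1 ≤ d → d ≤ 2 * k → ∀ {Y} → AllPairs _<_ Y → All (_< n) Y →
                         Span (between Y (⋃ (cover Y)))
  between-⋃-cover-span 1≤d d≤2k {Y} Y-sorted Y<n with length Y ≤? d
  ... | yes Y≤d = between-⋃-++-cover-span 1≤d Y-sorted Y<n [] [] (All.map (λ _ → refl) Y<n)
                                          (length-cover Y (≤-trans Y≤d d≤2k))
  ... | no Y≰d = Span-null λ x t → Y≰d (between⇒length≤ (⋃ (cover Y)) x (AllPairs.map <⇒≢ Y-sorted) t)

  between-span : 1 ≤ d → d ≤ 2 * k → ∀ fuel {Y} → Unique Y → All (_< n) Y → d < length Y + fuel →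
                 ∀ Z → Span (between Y Z)
  between-span 1≤d d≤2k fuel {Y} Y-unique Y<n d<Y+fuel Z with length Y ≤? d | All.all? (T? ∘ Z) Y
  ... | no Y≰d | _ = Span-null λ x t → Y≰d (between⇒length≤ Z x Y-unique t)
  ... | yes _ | no Y⊈Z = Span-null λ x t → Y⊈Z (between⇒⊆ x t)
  between-span 1≤d d≤2k zero {Y} _ _ d<Y+0 Z | yes Y≤d | yes _ =
    ⊥-elim (<⇒≱ d<Y+0 (subst (_≤ d) (sym (+-identityʳ (length Y))) Y≤d))
  between-span 1≤d d≤2k (suc fuel) {Y} Y-unique Y<n d<Y+1+fuel Z | yes _ | yes Y⊆Z =
    Span-resp-∼ X-span (pointwise-steps⇒∼ (between Y) (between-cong Y) X Z step)
    where
    Ys = filter (_∈? Y) (upTo n)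
    Ys-sorted = filter-upTo-sorted (_∈? Y) n
    X = ⋃ (cover Ys)

    Y⊆Ys : ∀ {y} → y ∈ Y → y ∈ Ys
    Y⊆Ys y∈Y = ∈-filter⁺ (_∈? Y) (∈-upTo⁺ (All.lookup Y<n y∈Y)) y∈Y

    Ys⊆Y : ∀ {y} → y ∈ Ys → y ∈ Y
    Ys⊆Y y∈Ys = proj₂ (∈-filter⁻ (_∈? Y) {xs = upTo n} y∈Ys)

    X-span : Span (between Y X)
    X-span = resp (between-⋃-cover-span 1≤d d≤2k Ys-sorted (filter-upTo-bounded (_∈? Y) n))
                  (λ x → cong (cube X x ∧_) (T-ext (all-anti-mono _ Y⊆Ys) (all-anti-mono _ Ys⊆Y)))

    step : ∀ j → j < n → X j ≢ Z j → ∀ W W′ → (∀ p → p ≢ j → W p ≡ W′ p) → between Y W ∼ between Y W′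
    step j j<n Xj≢Zj W W′ W≡W′ = between-exchange j Y W W′ W≡W′ (extended W) (extended W′)
      where
      j∉Y : j ∉ Y
      j∉Y j∈Y = Xj≢Zj (trans (to T-≡ (All.lookup (⋃-cover-∋ Ys-sorted) (Y⊆Ys j∈Y)))
                             (sym (to T-≡ (All.lookup Y⊆Z j∈Y))))
      extended : ∀ W → Span (between (j ∷ Y) W)
      extended = between-span 1≤d d≤2k fuel (¬Any⇒All¬ Y j∉Y ∷ Y-unique) (j<n ∷ Y<n)
                              (subst (d <_) (+-suc (length Y) fuel) d<Y+1+fuel)

  elements : Subset n → List ℕ
  elements S = filter (T? ∘ χ S) (upTo n)

  indV≗between : ∀ S → indV d S ≗ between (elements S) (χ S)
  indV≗between S x = ⌊⌋-≡ _ InV⇒between between⇒InV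
    where
    InV⇒between : InV d S x → T (between (elements S) (χ S) x)
    InV⇒between (x∈S , onto) = from T-∧ (T-cube⇐ (χ S) x (∈⇒χ ∘ x∈S) , T-covers⇐ (elements S) x hit)
      where
      hit : ∀ {y} → y ∈ elements S → ∃[ i ] toℕ (x i) ≡ y
      hit y∈ with ∈-filter⁻ (T? ∘ χ S) y∈
      ... | y∈upTo , S∋y with ∈-upTo⁻ y∈upTo
      ... | y<n with onto (fromℕ< y<n) (χ⇒∈ S _ (subst (T ∘ χ S) (sym (toℕ-fromℕ< y<n)) S∋y))
      ... | i , xᵢ≡y = i , trans (cong toℕ xᵢ≡y) (toℕ-fromℕ< y<n)

    between⇒InV : T (between (elements S) (χ S) x) → InV d S x
    between⇒InV t = (λ i → χ⇒∈ S (x i) (T-cube⇒ (χ S) x in-cube i)) , onto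
      where
      in-cube = proj₁ (T-between⇒ (elements S) (χ S) x t)
      onto : ∀ s → s ∈ₛ S → ∃[ i ] x i ≡ s
      onto s s∈S =
        let (i , xᵢ≡s) = T-covers⇒ (elements S) x (proj₂ (T-between⇒ (elements S) (χ S) x t))
                                     (∈-filter⁺ (T? ∘ χ S) (∈-upTo⁺ (toℕ<n s)) (∈⇒χ s∈S))
        in i , toℕ-injective xᵢ≡s

  indV-span : 1 ≤ d → d ≤ 2 * k → ∀ S → Span (indV d S)
  indV-span 1≤d d≤2k S =
    resp (between-span 1≤d d≤2k (suc d) elements-unique (filter-upTo-bounded _ n) d<S+1+d (χ S))
         (λ x → sym (indV≗between S x))
    where
    elements-unique = AllPairs.map <⇒≢ (filter-upTo-sorted (T? ∘ χ S) n)
    d<S+1+d = ≤-trans (n<1+n d) (m≤n+m (suc d) (length (elements S)))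

proposition3p3 : (k d n : ℕ) → 1 ≤ k → d ≡ 2 * k → d ≤ n →
    (T : Subset n) → 1 ≤ ∣ T ∣ → ∣ T ∣ ≤ d →
    InSpanCubes k d (indV d T)
proposition3p3 k d n 1≤k d≡2k _ S _ _ = Span⇒InSpanCubes (indV-span 1≤d (≤-reflexive d≡2k) S)
  where
  open Cubes n d k
  1≤d : 1 ≤ d
  1≤d = subst (1 ≤_) (sym d≡2k) (≤-trans 1≤k (m≤m+n k (k + 0)))
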